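{- Let $G$ be a graph whose vertex set is partitioned into $k$ cliques $V_1,\dots,V_k$, let $A=5$, $k'=Ak$, and let $G'$ be the graph constructed from $G$ as follows: for each vertex $u\in V(G)$ create an independent set $Z_u$ of $A$ new vertices; for each edge $uv\in E(G)$ add all edges between $Z_u$ and $Z_v$; for each $i\in\{1,\dots,k\}$ let $W_i=\bigcup_{u\in V_i}Z_u$ and add a new vertex $z_i$ adjacent to all vertices of $W_i$. If $G'$ has an upper dominating set of size at least $k'$, then $G$ has an independent set of size at least $k$.
   Context: A set $D$ of vertices is dominating if every vertex is in $D$ or adjacent to a vertex of $D$; an upper dominating set is an inclusion-minimal dominating set. The cliques $V_1,\dots,V_k$ may have arbitrary edges between them. -}

module Defs where

open import Data.Nat using (ℕ; _+_; _*_; _≤_)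
open import Data.Fin using (Fin; splitAt; remQuot)
open import Data.Fin.Subset using (Subset; _∈_; _⊂_; ∣_∣)
open import Data.Product using (Σ; ∃; _×_; _,_)
open import Data.Sum using (_⊎_; inj₁; inj₂)
open import Data.Empty using (⊥)
open import Relation.Binary.PropositionalEquality using (_≡_; _≢_)
open import Relation.Nullary using (¬_)

record Graph (n : ℕ) : Set₁ where
  field
    Adj     : Fin n → Fin n → Set
    sym     : ∀ {u v} → Adj u v → Adj v u
    irrefl  : ∀ {u} → ¬ Adj u u
open Graph public

Dominating : ∀ {N} → (Fin N → Fin N → Set) → Subset N → Set
Dominating {N} E D = ∀ (v : Fin N) → v ∈ D ⊎ Σ (Fin N) (λ u → u ∈ D × E u v)

-- Upper dominating set = inclusion-minimal dominating set.
MinimalDominating : ∀ {N} → (Fin N → Fin N → Set) → Subset N → Set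
MinimalDominating E D = Dominating E D × (∀ D' → D' ⊂ D → ¬ Dominating E D')

Independent : ∀ {n} → Graph n → Subset n → Set
Independent G I = ∀ u v → u ∈ I → v ∈ I → ¬ Adj G u v

IsCliquePartition : ∀ {n} k → Graph n → (Fin n → Fin k) → Set
IsCliquePartition {n} k G part =
  (∀ u v → part u ≡ part v → u ≢ v → Adj G u v) ×
  (∀ (i : Fin k) → ∃ λ u → part u ≡ i)

A : ℕ
A = 5

-- Vertices of G' : Fin (n * A + k).  The first n * A vertices are the Z_u
-- (vertex (u , a) via remQuot is the a-th element of Z_u); the last k are z_1..z_k.
Decode : ℕ → ℕ → Set
Decode n k = (Fin n × Fin A) ⊎ Fin k

decode : ∀ {n k} → Fin (n * A + k) → Decode n k
decode {n} x with splitAt (n * A) x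
... | inj₁ y = inj₁ (remQuot A y)
... | inj₂ i = inj₂ i

AdjD : ∀ {n k} → Graph n → (Fin n → Fin k) → Decode n k → Decode n k → Set
AdjD G part (inj₁ (u , _)) (inj₁ (v , _)) = Adj G u v
AdjD G part (inj₁ (u , _)) (inj₂ i) = part u ≡ i
AdjD G part (inj₂ i) (inj₁ (u , _)) = part u ≡ i
AdjD G part (inj₂ _) (inj₂ _) = ⊥

Adj' : ∀ {n k} → Graph n → (Fin n → Fin k) → Fin (n * A + k) → Fin (n * A + k) → Set
Adj' G part x y = AdjD G part (decode x) (decode y)

{-# OPTIONS --safe #-}
module Submission where

-- A minimal dominating set D gives every d ∈ D a private neighbour pn d, whose closed
-- neighbourhood meets D only in d.  For each clique V_i fix r_i ∈ V_i such that Z_(r_i)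
-- meets D whenever some Z_u with u ∈ V_i does, and send d to the pair (i, a) where
-- pn d ∈ W_i ∪ {z_i} and a is the position in Z_(r_i) of d or pn d.  This map is injective
-- on D: if z_i ∈ D it is the only element of D whose private neighbour is in class i, since
-- z_i is adjacent to all of W_i; otherwise z_i is dominated from some Z_u with u ∈ V_i, so
-- some x ∈ D lies in Z_(r_i), x is adjacent to every vertex of class i outside Z_(r_i), and
-- privacy forces d or pn d into Z_(r_i).  With |D| ≥ A k every class thus
-- receives A ≥ 3 elements of D.  Hence z_i ∉ D, so I = {u | Z_u ∩ D ≠ ∅} meets every
-- V_i; and if u, v ∈ I were adjacent, with x ∈ Z_u ∩ D and y ∈ Z_v ∩ D, privacy would force
-- every d ∈ D whose private neighbour is in the class of u to be x or y.

open import Defs hiding (sym)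
open import Data.Bool using (if_then_else_; true; false)
open import Data.Nat using (ℕ; _+_; _*_; _≤_; _<_; zero; suc; z≤n; s≤s; _≤?_)
open import Data.Nat.Properties using (*-comm; <⇒≱; module ≤-Reasoning)
open import Data.Fin using (Fin; zero; suc; join; splitAt; remQuot; combine)
open import Data.Fin.Properties
  using (_≟_; 0≢1+n; any?; ¬∀⟶∃¬; pigeonhole; suc-injective; splitAt-↑ʳ; join-splitAt;
         combine-remQuot; combine-injective; combine-injectiveˡ; combine-injectiveʳ)
  renaming (<⇒≢ to <⇒≢ᶠ)
open import Data.Fin.Subset using (Subset; _∈_; _∉_; ∣_∣; ⊤; _-_; inside; outside)
open import Data.Fin.Subset.Properties
  using (_∈?_; ∈⊤; ∣⊤∣≡n; x∈p⇒∣p-x∣<∣p∣; x∈p∧x≢y⇒x∈p-y; x∈p⇒p-x⊂p)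
open import Data.Product using (Σ; ∃; _×_; _,_; proj₁; proj₂; uncurry)
open import Data.Sum using (_⊎_; inj₁; inj₂; map₁)
open import Data.Empty using (⊥)
open import Data.Vec using (_∷_; []; tabulate; here; there)
open import Data.Vec.Properties using (lookup∘tabulate; lookup⇒[]=; []=⇒lookup)
open import Function using (_∘_; Injective)
open import Relation.Binary.PropositionalEquality
  using (_≡_; _≢_; refl; sym; trans; cong; subst; subst₂; module ≡-Reasoning)
open import Relation.Nullary using (¬_; Dec; yes; no; does)
open import Relation.Nullary.Decidable
  using (_×-dec_; _⊎-dec_; decidable-stable; dec-true; ¬¬-excluded-middle)
open import Relation.Nullary.Negation using (contradiction; ¬¬-map)

fromDec : ∀ {m} {P : Fin m → Set} → (∀ x → Dec (P x)) → Subset m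
fromDec P? = tabulate (does ∘ P?)

∈fromDec⁺ : ∀ {m} {P : Fin m → Set} (P? : ∀ x → Dec (P x)) {x} → P x → x ∈ fromDec P?
∈fromDec⁺ P? {x} px = lookup⇒[]= x _ (trans (lookup∘tabulate _ x) (dec-true (P? x) px))

∈fromDec⁻ : ∀ {m} {P : Fin m → Set} (P? : ∀ x → Dec (P x)) {x} → x ∈ fromDec P? → P x
∈fromDec⁻ P? {x} x∈ with P? x | trans (sym (lookup∘tabulate (does ∘ P?) x)) ([]=⇒lookup x∈)
... | yes px | _ = px
... | no _ | ()

InjectiveOn : ∀ {a b} → Subset a → (Fin a → Fin b) → Set
InjectiveOn P f = ∀ {x y} → x ∈ P → y ∈ P → f x ≡ f y → x ≡ y

injectiveOn-suc : ∀ {a b s} {P : Subset a} {f : Fin (suc a) → Fin b} →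
  InjectiveOn (s ∷ P) f → InjectiveOn P (f ∘ suc)
injectiveOn-suc f-inj x∈P y∈P = suc-injective ∘ f-inj (there x∈P) (there y∈P)

injectiveOn⇒∣p∣≤∣q∣ : ∀ {a b} {P : Subset a} {Q : Subset b} (f : Fin a → Fin b) →
  (∀ {x} → x ∈ P → f x ∈ Q) → InjectiveOn P f → ∣ P ∣ ≤ ∣ Q ∣
injectiveOn⇒∣p∣≤∣q∣ {P = []} f f∈Q f-inj = z≤n
injectiveOn⇒∣p∣≤∣q∣ {P = outside ∷ P} f f∈Q f-inj =
  injectiveOn⇒∣p∣≤∣q∣ (f ∘ suc) (f∈Q ∘ there) (injectiveOn-suc f-inj)
injectiveOn⇒∣p∣≤∣q∣ {P = inside ∷ P} {Q} f f∈Q f-inj = begin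
  suc ∣ P ∣             ≤⟨ s≤s (injectiveOn⇒∣p∣≤∣q∣ (f ∘ suc) f∘suc∈Q-f₀ (injectiveOn-suc f-inj)) ⟩
  suc ∣ Q - f zero ∣    ≤⟨ x∈p⇒∣p-x∣<∣p∣ (f∈Q here) ⟩
  ∣ Q ∣                 ∎
  where
  open ≤-Reasoning
  f∘suc∈Q-f₀ : ∀ {x} → x ∈ P → f (suc x) ∈ Q - f zero
  f∘suc∈Q-f₀ x∈P = x∈p∧x≢y⇒x∈p-y (f∈Q (there x∈P)) (0≢1+n ∘ f-inj here (there x∈P) ∘ sym)

injectiveOn⇒¬¬surjective : ∀ {a b} {P : Subset a} (f : Fin a → Fin b) → InjectiveOn P f →
  b ≤ ∣ P ∣ → ∀ s → ¬ ¬ (∃ λ x → x ∈ P × f x ≡ s)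
injectiveOn⇒¬¬surjective {b = b} {P} f f-inj b≤∣P∣ s s∉f[P] = <⇒≱ ∣P∣<b b≤∣P∣
  where
  open ≤-Reasoning
  ∣P∣<b : ∣ P ∣ < b
  ∣P∣<b = begin-strict
    ∣ P ∣      ≤⟨ injectiveOn⇒∣p∣≤∣q∣ f (λ x∈P → x∈p∧x≢y⇒x∈p-y ∈⊤ (λ e → s∉f[P] (_ , x∈P , e))) f-inj ⟩
    ∣ ⊤ - s ∣  <⟨ x∈p⇒∣p-x∣<∣p∣ (∈⊤ {x = s}) ⟩
    ∣ ⊤ {b} ∣  ≡⟨ ∣⊤∣≡n b ⟩
    b          ∎

¬¬-∀-Fin : ∀ {m} {P : Fin m → Set} → (∀ i → ¬ ¬ P i) → ¬ ¬ (∀ i → P i)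
¬¬-∀-Fin {zero} _ ¬∀ = ¬∀ λ ()
¬¬-∀-Fin {suc m} ¬¬P ¬∀ =
  ¬¬P zero λ P₀ → ¬¬-∀-Fin (¬¬P ∘ suc) λ P∘suc → ¬∀ λ { zero → P₀ ; (suc i) → P∘suc i }

module _ {X : Set} {x y : X} where

  side : ∀ {a} → a ≡ x ⊎ a ≡ y → Fin 2
  side (inj₁ _) = zero
  side (inj₂ _) = suc zero

  side-injective : ∀ {a b} (p : a ≡ x ⊎ a ≡ y) (q : b ≡ x ⊎ b ≡ y) → side p ≡ side q → a ≡ b
  side-injective (inj₁ a≡x) (inj₁ b≡x) _ = trans a≡x (sym b≡x)
  side-injective (inj₂ a≡y) (inj₂ b≡y) _ = trans a≡y (sym b≡y)

  two-valued⇒¬injective : ∀ {m} (f : Fin (3 + m) → X) → (∀ i → f i ≡ x ⊎ f i ≡ y) →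
                          ¬ Injective _≡_ _≡_ f
  two-valued⇒¬injective f f≡x⊎y f-inj
    with i , j , i<j , same ← pigeonhole (s≤s (s≤s (s≤s z≤n))) (side ∘ f≡x⊎y)
    = <⇒≢ᶠ i<j (f-inj (side-injective (f≡x⊎y i) (f≡x⊎y j) same))

module Domination {N : ℕ} (E : Fin N → Fin N → Set) where

  _∈N[_] : Fin N → Fin N → Set
  x ∈N[ v ] = x ≡ v ⊎ E x v

  DominatedBy : Subset N → Fin N → Set
  DominatedBy D v = v ∈ D ⊎ Σ (Fin N) (λ u → u ∈ D × E u v)

  dominatedBy⁺ : ∀ {D x v} → x ∈ D → x ∈N[ v ] → DominatedBy D v
  dominatedBy⁺ x∈D (inj₁ refl) = inj₁ x∈D
  dominatedBy⁺ x∈D (inj₂ xv) = inj₂ (_ , x∈D , xv)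

  dominatedBy⁻ : ∀ {D v} → DominatedBy D v → ∃ λ x → x ∈ D × x ∈N[ v ]
  dominatedBy⁻ (inj₁ v∈D) = _ , v∈D , inj₁ refl
  dominatedBy⁻ (inj₂ (u , u∈D , uv)) = u , u∈D , inj₂ uv

  IsPrivateNeighbour : Subset N → Fin N → Fin N → Set
  IsPrivateNeighbour D d v = d ∈N[ v ] × (∀ {x} → x ∈ D → x ∈N[ v ] → x ≡ d)

  module PrivateNeighbours (E? : ∀ u v → Dec (E u v)) {D : Subset N}
                           (D-min : MinimalDominating E D) where

    dominatedBy? : ∀ D′ v → Dec (DominatedBy D′ v)
    dominatedBy? D′ v = (v ∈? D′) ⊎-dec any? (λ u → (u ∈? D′) ×-dec E? u v)

    -- Minimality makes D - d non-dominating; a vertex it misses is a private neighbour of d.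
    -- Off D the choice v = d is a junk value.
    private-neighbour : ∀ d → ∃ λ v → d ∈ D → IsPrivateNeighbour D d v
    private-neighbour d with d ∈? D
    ... | no d∉D = d , λ d∈D → contradiction d∈D d∉D
    ... | yes d∈D
      with v , ¬dominated ← ¬∀⟶∃¬ N _ (dominatedBy? (D - d)) (proj₂ D-min (D - d) (x∈p⇒p-x⊂p d∈D))
      = v , λ _ → d∈N[v] , unique
      where
      unique : ∀ {x} → x ∈ D → x ∈N[ v ] → x ≡ d
      unique {x} x∈D x∈N[v] = decidable-stable (x ≟ d)
        (λ x≢d → ¬dominated (dominatedBy⁺ (x∈p∧x≢y⇒x∈p-y x∈D x≢d) x∈N[v]))
      d∈N[v] : d ∈N[ v ]
      d∈N[v] with x , x∈D , x∈N[v] ← dominatedBy⁻ (proj₁ D-min v) =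
        subst (_∈N[ v ]) (unique x∈D x∈N[v]) x∈N[v]

    pn : Fin N → Fin N
    pn d = proj₁ (private-neighbour d)

    pn-private : ∀ {d} → d ∈ D → IsPrivateNeighbour D d (pn d)
    pn-private {d} = proj₂ (private-neighbour d)

    pn-unique : ∀ {d x} → d ∈ D → x ∈ D → x ∈N[ pn d ] → x ≡ d
    pn-unique d∈D = proj₂ (pn-private d∈D)

    private-collision : ∀ {d d′ t} → d ∈ D → d′ ∈ D →
      t ≡ d ⊎ t ≡ pn d → t ≡ d′ ⊎ t ≡ pn d′ → d ≡ d′
    private-collision _ _ (inj₁ refl) (inj₁ refl) = refl
    private-collision d∈D d′∈D (inj₁ refl) (inj₂ t≡pn[d′]) = pn-unique d′∈D d∈D (inj₁ t≡pn[d′])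
    private-collision d∈D d′∈D (inj₂ t≡pn[d]) (inj₁ refl) = sym (pn-unique d∈D d′∈D (inj₁ t≡pn[d]))
    private-collision d∈D d′∈D (inj₂ refl) (inj₂ pn[d]≡pn[d′]) =
      pn-unique d′∈D d∈D (subst (_ ∈N[_]) pn[d]≡pn[d′] (proj₁ (pn-private d∈D)))

module Construction {n k : ℕ} (G : Graph n) (part : Fin n → Fin k) where

  N : ℕ
  N = n * A + k

  open Domination (Adj' G part) public

  encode : Decode n k → Fin N
  encode = join (n * A) k ∘ map₁ (λ (u , a) → combine u a)

  decode-splitAt : ∀ x → decode {n} {k} x ≡ map₁ (remQuot A) (splitAt (n * A) x)
  decode-splitAt x with splitAt (n * A) x
  ... | inj₁ _ = refl
  ... | inj₂ _ = refl

  encode-decode : ∀ x → encode (decode x) ≡ x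
  encode-decode x = begin
    encode (decode x)                                  ≡⟨ cong encode (decode-splitAt x) ⟩
    encode (map₁ (remQuot {n} A) (splitAt (n * A) x))  ≡⟨ cong (join (n * A) k) (combine∘remQuot s) ⟩
    join (n * A) k s                                   ≡⟨ join-splitAt (n * A) k x ⟩
    x                                                  ∎
    where
    open ≡-Reasoning
    s : Fin (n * A) ⊎ Fin k
    s = splitAt (n * A) x
    combine∘remQuot : ∀ (s : Fin (n * A) ⊎ Fin k) →
      map₁ (λ (u , a) → combine u a) (map₁ (remQuot {n} A) s) ≡ s
    combine∘remQuot (inj₁ y) = cong inj₁ (combine-remQuot {n} A y)
    combine∘remQuot (inj₂ i) = refl

  decode-injective : ∀ {x y} → decode {n} {k} x ≡ decode y → x ≡ y
  decode-injective {x} {y} e = trans (sym (encode-decode x)) (trans (cong encode e) (encode-decode y))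

  z : Fin k → Fin N
  z i = encode (inj₂ i)

  decode-z : ∀ i → decode (z i) ≡ inj₂ i
  decode-z i = trans (decode-splitAt (z i)) (cong (map₁ (remQuot A)) (splitAt-↑ʳ (n * A) k i))

  -- x ∈Z u says x ∈ Z_u, and class x = i says x ∈ W_i ∪ {z_i}.
  classD : Decode n k → Fin k
  classD (inj₁ (u , _)) = part u
  classD (inj₂ i) = i

  InZ : Fin n → Decode n k → Set
  InZ u (inj₁ (w , _)) = w ≡ u
  InZ u (inj₂ _) = ⊥

  indexD : Decode n k → Fin A
  indexD (inj₁ (_ , a)) = a
  indexD (inj₂ _) = zero

  InZ-injective : ∀ {u a b} → InZ u a → InZ u b → indexD a ≡ indexD b → a ≡ b
  InZ-injective {a = inj₁ _} {inj₁ _} refl refl refl = refl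

  class : Fin N → Fin k
  class x = classD (decode x)

  _∈Z_ : Fin N → Fin n → Set
  x ∈Z u = InZ u (decode x)

  _∈Z?_ : ∀ x u → Dec (x ∈Z u)
  x ∈Z? u = InZ? (decode x)
    where
    InZ? : ∀ a → Dec (InZ u a)
    InZ? (inj₁ (w , _)) = w ≟ u
    InZ? (inj₂ _) = no λ ()

  Adj′? : (∀ u v → Dec (Adj G u v)) → ∀ x y → Dec (Adj' G part x y)
  Adj′? Adj? x y = AdjD? (decode x) (decode y)
    where
    AdjD? : ∀ a b → Dec (AdjD G part a b)
    AdjD? (inj₁ (u , _)) (inj₁ (v , _)) = Adj? u v
    AdjD? (inj₁ (u , _)) (inj₂ i) = part u ≟ i
    AdjD? (inj₂ i) (inj₁ (u , _)) = part u ≟ i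
    AdjD? (inj₂ _) (inj₂ _) = no λ ()

  z-dominates : ∀ v → z (class v) ∈N[ v ]
  z-dominates v = z-dominatesD (decode v) refl
    where
    z-dominatesD : ∀ b → decode v ≡ b → z (classD b) ∈N[ v ]
    z-dominatesD (inj₁ (u , _)) eq = inj₂ (subst₂ (AdjD G part) (sym (decode-z (part u))) (sym eq) refl)
    z-dominatesD (inj₂ i) eq = inj₁ (decode-injective (trans (decode-z i) (sym eq)))

  z-neighbour : ∀ {x i} → Adj' G part x (z i) → ∃ λ u → x ∈Z u × part u ≡ i
  z-neighbour {x} {i} adj = z-neighbourD (decode x) (subst (AdjD G part (decode x)) (decode-z i) adj)
    where
    z-neighbourD : ∀ a → AdjD G part a (inj₂ i) → ∃ λ u → InZ u a × part u ≡ i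
    z-neighbourD (inj₁ (u , _)) part[u]≡i = u , refl , part[u]≡i

  Z-adjacent : ∀ {x y u v} → x ∈Z u → y ∈Z v → Adj G u v → Adj' G part x y
  Z-adjacent {x} {y} = Z-adjacentD (decode x) (decode y)
    where
    Z-adjacentD : ∀ {u v} a b → InZ u a → InZ v b → Adj G u v → AdjD G part a b
    Z-adjacentD (inj₁ _) (inj₁ _) refl refl uv = uv

  module _ (clique : ∀ u v → part u ≡ part v → u ≢ v → Adj G u v) where

    Z-adjacent-class : ∀ {x v u} → x ∈Z u → class v ≡ part u → ¬ v ∈Z u → Adj' G part x v
    Z-adjacent-class {x} {v} = Z-adjacent-classD (decode x) (decode v)
      where
      Z-adjacent-classD : ∀ {u} a b → InZ u a → classD b ≡ part u → ¬ InZ u b → AdjD G part a b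
      Z-adjacent-classD (inj₁ (u , _)) (inj₁ (w , _)) refl part[w]≡part[u] w≢u =
        clique u w (sym part[w]≡part[u]) (w≢u ∘ sym)
      Z-adjacent-classD (inj₁ _) (inj₂ _) refl i≡part[u] _ = sym i≡part[u]

module Reduction {n k : ℕ} (G : Graph n) (part : Fin n → Fin k) (cp : IsCliquePartition k G part)
                 (D : Subset (n * A + k)) where

  open Construction G part public

  meets-D? : ∀ u → Dec (∃ λ x → x ∈ D × x ∈Z u)
  meets-D? u = any? λ x → (x ∈? D) ×-dec (x ∈Z? u)

  I : Subset n
  I = fromDec meets-D?

  ∈I⁺ : ∀ {x u} → x ∈ D → x ∈Z u → u ∈ I
  ∈I⁺ x∈D x∈Z = ∈fromDec⁺ meets-D? (_ , x∈D , x∈Z)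

  ∈I⁻ : ∀ {u} → u ∈ I → ∃ λ x → x ∈ D × x ∈Z u
  ∈I⁻ = ∈fromDec⁻ meets-D?

  anchor-spec : ∀ i → ∃ λ r → part r ≡ i × (∀ {u} → u ∈ I → part u ≡ i → r ∈ I)
  anchor-spec i with any? (λ u → (u ∈? I) ×-dec (part u ≟ i))
  ... | yes (u , u∈I , part[u]≡i) = u , part[u]≡i , λ _ _ → u∈I
  ... | no none = proj₁ (proj₂ cp i) , proj₂ (proj₂ cp i)
                , λ u∈I part[u]≡i → contradiction (_ , u∈I , part[u]≡i) none

  anchor : Fin k → Fin n
  anchor i = proj₁ (anchor-spec i)

  anchor-part : ∀ i → part (anchor i) ≡ i
  anchor-part i = proj₁ (proj₂ (anchor-spec i))

  anchor-injective : Injective _≡_ _≡_ anchor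
  anchor-injective {i} {j} e = trans (sym (anchor-part i)) (trans (cong part e) (anchor-part j))

  z∉D⇒anchor∈I : Dominating (Adj' G part) D → ∀ {i} → z i ∉ D → anchor i ∈ I
  z∉D⇒anchor∈I D-dom {i} z∉D with D-dom (z i)
  ... | inj₁ z∈D = contradiction z∈D z∉D
  ... | inj₂ (x , x∈D , adj) with u , x∈Z , part[u]≡i ← z-neighbour adj
    = proj₂ (proj₂ (anchor-spec i)) (∈I⁺ x∈D x∈Z) part[u]≡i

  module _ (D-min : MinimalDominating (Adj' G part) D) (Adj? : ∀ u v → Dec (Adj G u v))
           (large : A * k ≤ ∣ D ∣) where

    open PrivateNeighbours (Adj′? Adj?) D-min

    class∘pn : Fin N → Fin k
    class∘pn d = class (pn d)

    z-owner : ∀ {d i} → d ∈ D → class∘pn d ≡ i → z i ∈ D → z i ≡ d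
    z-owner {d} d∈D refl z∈D = pn-unique d∈D z∈D (z-dominates (pn d))

    locus : Fin N → Fin N
    locus d = if does (d ∈Z? anchor (class∘pn d)) then d else pn d

    locus-either : ∀ d → locus d ≡ d ⊎ locus d ≡ pn d
    locus-either d with does (d ∈Z? anchor (class∘pn d))
    ... | true = inj₁ refl
    ... | false = inj₂ refl

    locus-∈Z : ∀ {d} → d ∈ D → z (class∘pn d) ∉ D → locus d ∈Z anchor (class∘pn d)
    locus-∈Z {d} d∈D z∉D
      with x , x∈D , x∈Z ← ∈I⁻ (z∉D⇒anchor∈I (proj₁ D-min) z∉D)
         | d ∈Z? anchor (class∘pn d) | pn d ∈Z? anchor (class∘pn d)
    ... | yes d∈Z | _ = d∈Z
    ... | no _ | yes pn[d]∈Z = pn[d]∈Z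
    ... | no d∉Z | no pn[d]∉Z = contradiction (subst (_∈Z anchor (class∘pn d)) x≡d x∈Z) d∉Z
      where
      x≡d : x ≡ d
      x≡d = pn-unique d∈D x∈D
        (inj₂ (Z-adjacent-class (proj₁ cp) x∈Z (sym (anchor-part (class∘pn d))) pn[d]∉Z))

    slot : Fin N → Fin (k * A)
    slot d = combine (class∘pn d) (indexD (decode (locus d)))

    slot-injective : InjectiveOn D slot
    slot-injective {d} {d′} d∈D d′∈D slot[d]≡slot[d′]
      with class≡ , index≡ ← combine-injective (class∘pn d) _ (class∘pn d′) _ slot[d]≡slot[d′]
         | z (class∘pn d) ∈? D
    ... | yes z∈D = trans (sym (z-owner d∈D refl z∈D)) (z-owner d′∈D (sym class≡) z∈D)
    ... | no z∉D = private-collision d∈D d′∈D (locus-either d)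
                     (subst (λ t → t ≡ d′ ⊎ t ≡ pn d′) (sym locus≡) (locus-either d′))
      where
      locus′-∈Z : locus d′ ∈Z anchor (class∘pn d)
      locus′-∈Z = subst (λ i → locus d′ ∈Z anchor i) (sym class≡)
                    (locus-∈Z d′∈D (subst (λ i → z i ∉ D) class≡ z∉D))
      locus≡ : locus d ≡ locus d′
      locus≡ = decode-injective (InZ-injective (locus-∈Z d∈D z∉D) locus′-∈Z index≡)

    class-fibre : ∀ i →
      ¬ ¬ (∃ λ (f : Fin A → Fin N) → (∀ a → f a ∈ D × class∘pn (f a) ≡ i) × Injective _≡_ _≡_ f)
    class-fibre i =
      ¬¬-map fibre (¬¬-∀-Fin λ a → injectiveOn⇒¬¬surjective slot slot-injective k*A≤∣D∣ (combine i a))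
      where
      k*A≤∣D∣ : k * A ≤ ∣ D ∣
      k*A≤∣D∣ = subst (_≤ ∣ D ∣) (*-comm A k) large
      fibre : (∀ a → ∃ λ d → d ∈ D × slot d ≡ combine i a) →
              ∃ λ (f : Fin A → Fin N) → (∀ a → f a ∈ D × class∘pn (f a) ≡ i) × Injective _≡_ _≡_ f
      fibre hit = proj₁ ∘ hit
                , (λ a → proj₁ (proj₂ (hit a)) , combine-injectiveˡ _ _ i a (slot≡ a))
                , λ {a} {b} f[a]≡f[b] → combine-injectiveʳ i a i b (begin
                    combine i a          ≡⟨ slot≡ a ⟨
                    slot (proj₁ (hit a)) ≡⟨ cong slot f[a]≡f[b] ⟩
                    slot (proj₁ (hit b)) ≡⟨ slot≡ b ⟩
                    combine i b          ∎)
        where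
        open ≡-Reasoning
        slot≡ : ∀ a → slot (proj₁ (hit a)) ≡ combine i a
        slot≡ a = proj₂ (proj₂ (hit a))

    z∉D : ∀ i → z i ∉ D
    z∉D i z∈D = class-fibre i λ (f , f∈fibre , f-inj) →
      two-valued⇒¬injective {y = z i} f (λ a → inj₁ (sym (uncurry z-owner (f∈fibre a) z∈D))) f-inj

    I-independent : Independent G I
    I-independent u v u∈I v∈I uv
      with x , x∈D , x∈Z ← ∈I⁻ u∈I | y , y∈D , y∈Z ← ∈I⁻ v∈I
      = class-fibre (part u) λ (f , f∈fibre , f-inj) →
          two-valued⇒¬injective f (uncurry x-or-y ∘ f∈fibre) f-inj
      where
      x-or-y : ∀ {d} → d ∈ D → class∘pn d ≡ part u → d ≡ x ⊎ d ≡ y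
      x-or-y {d} d∈D class≡part[u] with pn d ∈Z? u
      ... | yes pn[d]∈Z =
        inj₂ (sym (pn-unique d∈D y∈D (inj₂ (Z-adjacent y∈Z pn[d]∈Z (Graph.sym G uv)))))
      ... | no pn[d]∉Z =
        inj₁ (sym (pn-unique d∈D x∈D (inj₂ (Z-adjacent-class (proj₁ cp) x∈Z class≡part[u] pn[d]∉Z))))

    I-large : k ≤ ∣ I ∣
    I-large = subst (_≤ ∣ I ∣) (∣⊤∣≡n k)
      (injectiveOn⇒∣p∣≤∣q∣ {P = ⊤} anchor (λ {i} _ → z∉D⇒anchor∈I (proj₁ D-min) (z∉D i))
                                         (λ _ _ → anchor-injective))

lemma2 : ∀ {n : ℕ} (k : ℕ) (G : Graph n) (part : Fin n → Fin k) →
    IsCliquePartition k G part →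
    Σ (Subset (n * A + k)) (λ D → MinimalDominating (Adj' G part) D × A * k ≤ ∣ D ∣) →
    Σ (Subset n) (λ I → Independent G I × k ≤ ∣ I ∣)
lemma2 k G part cp (D , D-min , large) = I , independent , k≤∣I∣
  where
  open Reduction G part cp D
  -- Adjacency need not be decidable, but both conclusions are stable under double negation.
  Adj-¬¬decidable : ¬ ¬ (∀ u v → Dec (Adj G u v))
  Adj-¬¬decidable = ¬¬-∀-Fin λ u → ¬¬-∀-Fin λ v → ¬¬-excluded-middle
  independent : Independent G I
  independent u v u∈I v∈I uv = Adj-¬¬decidable λ Adj? → I-independent D-min Adj? large u v u∈I v∈I uv
  k≤∣I∣ : k ≤ ∣ I ∣
  k≤∣I∣ = decidable-stable (k ≤? ∣ I ∣) λ k≰∣I∣ →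
    Adj-¬¬decidable λ Adj? → k≰∣I∣ (I-large D-min Adj? large)
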